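{- Let $x$ be a vertex of a finite bipartite graph $G$. Then there is an injection $\mathcal A_{N(x)}\to\mathcal A_x$.
   Context: For a set $X$ of vertices of $G$, $\mathcal A_X$ denotes the set of maximal (under inclusion) stable sets of $G$ containing all of $X$, and $\mathcal A_x=\mathcal A_{\{x\}}$. $N(x)$ is the set of neighbours of $x$. A set of vertices is stable if no two of its vertices are adjacent. -}

module Defs where

open import Data.Nat using (ℕ)
open import Data.Bool using (Bool)
open import Data.Fin using (Fin)
open import Data.Fin.Subset using (Subset; _∈_; _⊆_; ⁅_⁆)
open import Data.Vec using (tabulate)
open import Data.Product using (Σ; _×_; proj₁)
open import Relation.Nullary using (¬_; Dec; does)
open import Relation.Binary.PropositionalEquality using (_≡_; _≢_)
open import Level using (0ℓ)

record Graph (n : ℕ) : Set₁ where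
  field
    Adj     : Fin n → Fin n → Set
    adj?    : ∀ u v → Dec (Adj u v)
    sym     : ∀ {u v} → Adj u v → Adj v u
    irrefl  : ∀ {u} → ¬ Adj u u

module _ {n : ℕ} (G : Graph n) where
  open Graph G

  Bipartite : Set
  Bipartite = Σ (Fin n → Bool) λ c → ∀ {u v} → Adj u v → c u ≢ c v

  N : Fin n → Subset n
  N x = tabulate (λ v → does (adj? x v))

  Stable : Subset n → Set
  Stable S = ∀ {u v} → u ∈ S → v ∈ S → ¬ Adj u v

  MaximalStable : Subset n → Set
  MaximalStable S = Stable S × (∀ T → Stable T → S ⊆ T → T ⊆ S)

  InA : Subset n → Subset n → Set
  InA X S = MaximalStable S × X ⊆ S

  𝒜 : Subset n → Set
  𝒜 X = Σ (Subset n) (InA X)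

  𝒜ᵥ : Fin n → Set
  𝒜ᵥ x = 𝒜 ⁅ x ⁆

Injection𝒜 : ∀ {n} {P Q : Subset n → Set} →
             (Σ (Subset n) P → Σ (Subset n) Q) → Set
Injection𝒜 f = ∀ a b → proj₁ (f a) ≡ proj₁ (f b) → proj₁ a ≡ proj₁ b

-- Let A be the colour class of x and B the other one. A set S ∈ 𝒜_{N(x)} is sent to
-- the maximal stable set generated by Y = (S ∩ B) ∖ N(x), namely Y ∪ (A ∖ N(Y)), which
-- contains x. Since N(x) ⊆ S ∩ B ⊆ N(x) ∪ Y, the image determines S ∩ B, and in a
-- bipartite graph a maximal stable set is determined by its trace on one colour class.
module Submission where

open import Defs
open import Data.Nat using (ℕ)
open import Data.Bool using (Bool)
open import Data.Bool.Properties using (¬-not) renaming (_≟_ to _≟ᴮ_)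
open import Data.Fin using (Fin)
open import Data.Fin.Properties using (all?)
open import Data.Fin.Subset using (Subset; _∈_; _⊆_; _∪_; ⁅_⁆)
open import Data.Fin.Subset.Properties
  using (_∈?_; x∈p∪q⁺; x∈p∪q⁻; x∈⁅x⁆; x∈⁅y⁆⇒x≡y; ⊆-antisym)
open import Data.Vec using (tabulate)
open import Data.Vec.Properties using ([]=⇒lookup; lookup⇒[]=; lookup∘tabulate)
open import Data.Product using (Σ; _×_; _,_; proj₁; proj₂)
open import Data.Sum using (_⊎_; inj₁; inj₂)
open import Data.Empty using (⊥-elim)
open import Level using (0ℓ)
open import Relation.Nullary using (¬_; yes; no; does)
open import Relation.Nullary.Decidable using (dec-true; ¬?; _×-dec_; _→-dec_)
open import Relation.Unary using (Pred; Decidable)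
open import Relation.Binary.PropositionalEquality
  using (_≡_; _≢_; refl; sym; trans; subst)

module _ {n : ℕ} {P : Pred (Fin n) 0ℓ} (P? : Decidable P) where

  toSubset : Subset n
  toSubset = tabulate (λ v → does (P? v))

  ∈-toSubset⁺ : ∀ {v} → P v → v ∈ toSubset
  ∈-toSubset⁺ {v} p = lookup⇒[]= v _ (trans (lookup∘tabulate _ v) (dec-true (P? v) p))

  ∈-toSubset⁻ : ∀ {v} → v ∈ toSubset → P v
  ∈-toSubset⁻ {v} m with P? v | trans (sym (lookup∘tabulate _ v)) ([]=⇒lookup m)
  ... | yes p | _ = p
  ... | no _ | ()

module _ {n : ℕ} (G : Graph n) where
  open Graph G renaming (sym to adj-sym)

  Absorbing : Subset n → Set
  Absorbing S = ∀ w → (∀ u → u ∈ S → ¬ Adj u w) → w ∈ S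

  maximalStable⇒absorbing : ∀ {S} → MaximalStable G S → Absorbing S
  maximalStable⇒absorbing {S} (stable , maximal) w w-free =
    maximal (S ∪ ⁅ w ⁆) stable-S∪w (λ m → x∈p∪q⁺ (inj₁ m)) (x∈p∪q⁺ (inj₂ (x∈⁅x⁆ w)))
    where
      stable-S∪w : Stable G (S ∪ ⁅ w ⁆)
      stable-S∪w {u} {v} mu mv with x∈p∪q⁻ S _ mu | x∈p∪q⁻ S _ mv
      ... | inj₁ u∈S | inj₁ v∈S = stable u∈S v∈S
      ... | inj₁ u∈S | inj₂ v∈w rewrite x∈⁅y⁆⇒x≡y w v∈w = w-free u u∈S
      ... | inj₂ u∈w | inj₁ v∈S rewrite x∈⁅y⁆⇒x≡y w u∈w = λ e → w-free v v∈S (adj-sym e)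
      ... | inj₂ u∈w | inj₂ v∈w rewrite x∈⁅y⁆⇒x≡y w u∈w | x∈⁅y⁆⇒x≡y w v∈w = irrefl

  absorbing⇒maximalStable : ∀ {S} → Stable G S → Absorbing S → MaximalStable G S
  absorbing⇒maximalStable stable absorbing =
    stable , λ T stable-T S⊆T {w} w∈T →
      absorbing w (λ u u∈S → stable-T (S⊆T u∈S) w∈T)

module ColourClass {n : ℕ} (G : Graph n) (bipartite : Bipartite G) (a : Bool) where
  open Graph G renaming (sym to adj-sym)
  private
    c = proj₁ bipartite
    proper = proj₂ bipartite

  adj-side⇒other : ∀ {u v} → Adj u v → c u ≡ a → c v ≢ a
  adj-side⇒other e cu≡a cv≡a = proper e (trans cu≡a (sym cv≡a))

  adj-other⇒side : ∀ {u v} → Adj u v → c u ≢ a → c v ≡ a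
  adj-other⇒side {v = v} e cu≢a with c v ≟ᴮ a
  ... | yes cv≡a = cv≡a
  ... | no cv≢a = ⊥-elim (proper e (trans (¬-not cu≢a) (sym (¬-not cv≢a))))

  ⊆-from-other-side : ∀ {S₁ S₂} → Stable G S₁ → Absorbing G S₂ →
    (∀ {v} → c v ≢ a → v ∈ S₁ → v ∈ S₂) → (∀ {v} → c v ≢ a → v ∈ S₂ → v ∈ S₁) →
    S₁ ⊆ S₂
  ⊆-from-other-side stable₁ absorbing₂ other₁⊆₂ other₂⊆₁ {v} v∈S₁ with c v ≟ᴮ a
  ... | no cv≢a = other₁⊆₂ cv≢a v∈S₁
  ... | yes cv≡a = absorbing₂ v λ u u∈S₂ e →
    stable₁ (other₂⊆₁ (adj-side⇒other (adj-sym e) cv≡a) u∈S₂) v∈S₁ e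

module _ {n : ℕ} (G : Graph n) (bipartite : Bipartite G) (x : Fin n) where
  open Graph G using (Adj; adj?) renaming (sym to adj-sym)
  private
    c = proj₁ bipartite
    a = c x
  open ColourClass G bipartite a

  module _ (S : Subset n) where

    -- Rest is the set Y of the proof idea, and φ = Y ∪ (A ∖ N(Y)).
    Rest : Pred (Fin n) 0ℓ
    Rest u = u ∈ S × c u ≢ a × ¬ Adj x u

    rest? : Decidable Rest
    rest? u = (u ∈? S) ×-dec (¬? (c u ≟ᴮ a) ×-dec ¬? (adj? x u))

    FreeOfRest : Pred (Fin n) 0ℓ
    FreeOfRest v = c v ≡ a × (∀ u → Rest u → ¬ Adj u v)

    free? : Decidable FreeOfRest
    free? v = (c v ≟ᴮ a) ×-dec all? (λ u → rest? u →-dec ¬? (adj? u v))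

    φ : Subset n
    φ = toSubset rest? ∪ toSubset free?

    ∈φ-rest : ∀ {v} → Rest v → v ∈ φ
    ∈φ-rest r = x∈p∪q⁺ (inj₁ (∈-toSubset⁺ rest? r))

    ∈φ-free : ∀ {v} → c v ≡ a → (∀ u → Rest u → ¬ Adj u v) → v ∈ φ
    ∈φ-free cv≡a free = x∈p∪q⁺ (inj₂ (∈-toSubset⁺ free? (cv≡a , free)))

    x∈φ : x ∈ φ
    x∈φ = ∈φ-free refl λ u (_ , _ , ¬x~u) e → ¬x~u (adj-sym e)

    ∈φ⁻ : ∀ {v} → v ∈ φ → Rest v ⊎ FreeOfRest v
    ∈φ⁻ v∈φ with x∈p∪q⁻ (toSubset rest?) _ v∈φ
    ... | inj₁ r = inj₁ (∈-toSubset⁻ rest? r)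
    ... | inj₂ f = inj₂ (∈-toSubset⁻ free? f)

    ∈φ-other⇒∈ : ∀ {v} → v ∈ φ → c v ≢ a → v ∈ S
    ∈φ-other⇒∈ v∈φ cv≢a with ∈φ⁻ v∈φ
    ... | inj₁ (v∈S , _) = v∈S
    ... | inj₂ (cv≡a , _) = ⊥-elim (cv≢a cv≡a)

    stable-φ : Stable G φ
    stable-φ {u} {v} u∈φ v∈φ e with ∈φ⁻ u∈φ | ∈φ⁻ v∈φ
    ... | inj₁ (_ , cu≢a , _) | inj₁ (_ , cv≢a , _) = cv≢a (adj-other⇒side e cu≢a)
    ... | inj₁ ru | inj₂ (_ , v-free) = v-free u ru e
    ... | inj₂ (_ , u-free) | inj₁ rv = u-free v rv (adj-sym e)
    ... | inj₂ (cu≡a , _) | inj₂ (cv≡a , _) = adj-side⇒other e cu≡a cv≡a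

    absorbing-φ : MaximalStable G S → Absorbing G φ
    absorbing-φ S-max w w-free with c w ≟ᴮ a
    ... | yes cw≡a = ∈φ-free cw≡a λ u r → w-free u (∈φ-rest r)
    ... | no cw≢a = ∈φ-rest (w∈S , cw≢a , λ e → w-free x x∈φ e)
      where
        S∩A⊆φ : ∀ {u} → u ∈ S → c u ≡ a → u ∈ φ
        S∩A⊆φ u∈S cu≡a = ∈φ-free cu≡a λ y (y∈S , _) → proj₁ S-max y∈S u∈S

        w∈S : w ∈ S
        w∈S = maximalStable⇒absorbing G S-max w λ u u∈S e →
          w-free u (S∩A⊆φ u∈S (adj-other⇒side (adj-sym e) cw≢a)) e

  φ-∈𝒜 : ∀ {S} → InA G (N G x) S → InA G ⁅ x ⁆ (φ S)
  φ-∈𝒜 {S} (S-max , _) =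
    absorbing⇒maximalStable G (stable-φ S) (absorbing-φ S S-max) ,
    λ m → subst (_∈ φ S) (sym (x∈⁅y⁆⇒x≡y x m)) (x∈φ S)

  φ-other-side : ∀ {S₁ S₂} → N G x ⊆ S₂ → φ S₁ ≡ φ S₂ →
    ∀ {v} → c v ≢ a → v ∈ S₁ → v ∈ S₂
  φ-other-side N⊆S₂ φ₁≡φ₂ {v} cv≢a v∈S₁ with adj? x v
  ... | yes x~v = N⊆S₂ (∈-toSubset⁺ (adj? x) x~v)
  ... | no ¬x~v = ∈φ-other⇒∈ _ (subst (v ∈_) φ₁≡φ₂ (∈φ-rest _ (v∈S₁ , cv≢a , ¬x~v))) cv≢a

  φ-injective : ∀ {S₁ S₂} → InA G (N G x) S₁ → InA G (N G x) S₂ → φ S₁ ≡ φ S₂ → S₁ ≡ S₂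
  φ-injective (S₁-max , N⊆S₁) (S₂-max , N⊆S₂) φ₁≡φ₂ = ⊆-antisym
    (⊆-from-other-side (proj₁ S₁-max) (maximalStable⇒absorbing G S₂-max)
      (φ-other-side N⊆S₂ φ₁≡φ₂) (φ-other-side N⊆S₁ (sym φ₁≡φ₂)))
    (⊆-from-other-side (proj₁ S₂-max) (maximalStable⇒absorbing G S₁-max)
      (φ-other-side N⊆S₁ (sym φ₁≡φ₂)) (φ-other-side N⊆S₂ φ₁≡φ₂))

lemma6 : ∀ {n : ℕ} (G : Graph n) → Bipartite G → (x : Fin n) →
           Σ (𝒜 G (N G x) → 𝒜ᵥ G x) Injection𝒜
lemma6 G bipartite x =
  (λ (S , S∈𝒜) → φ G bipartite x S , φ-∈𝒜 G bipartite x S∈𝒜) ,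
  λ (_ , S₁∈𝒜) (_ , S₂∈𝒜) → φ-injective G bipartite x S₁∈𝒜 S₂∈𝒜
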